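{- Let KH denote the statement: for every integer $n>2$, $n$ does not divide $!n$. Then KH is equivalent to each one of the following six statements (that is, for each $i\in\{1,\dots,6\}$, KH holds if and only if statement $(i)$ holds): (1) For every odd prime $p$, in the field $\mathrm{GF}(p)$ one has $\displaystyle\sum_{k=0}^{p-1}(-1)^k (k+1)(k+2)\cdots(p-1)\neq 0$. (2) For every odd prime $p$, $\displaystyle\sum_{k=0}^{p-1}(-1)^k (k+1)(k+2)\cdots(p-1)\not\equiv 0 \pmod p$. (3) For every odd prime $p$, in $\mathrm{GF}(p)$ one has $\displaystyle\sum_{k=0}^{p-1}\binom{p-1}{k}(k+1)(k+2)\cdots(p-1)\neq 0$. (4) For every odd prime $p$, $\displaystyle\sum_{k=0}^{p-1}\binom{p-1}{k}(k+1)(k+2)\cdots(p-1)\not\equiv 0 \pmod p$. (5) For every odd prime $p$, in $\mathrm{GF}(p)$ one has $\displaystyle\sum_{k=0}^{p-1}\frac{(-1)^k}{k!}\neq 0$. (6) For every odd prime $p$, in $\mathrm{GF}(p)$ one has $\displaystyle\sum_{k=0}^{p-1}\frac{1}{k!}\binom{p-1}{k}\neq 0$.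
   Context: For a positive integer $n$, the left factorial is $!n=\sum_{i=0}^{n-1} i!$. $\mathrm{GF}(p)$ denotes the field with $p$ elements ($p$ prime); integers are interpreted in $\mathrm{GF}(p)$ via reduction mod $p$, and $1/k!$ is the inverse of $k!$ in $\mathrm{GF}(p)$ (which exists for $0\le k\le p-1$). For $k=p-1$ the product $(k+1)(k+2)\cdots(p-1)$ is the empty product $1$. -}

module Defs where

open import Data.Nat using (ℕ; zero; suc; _+_; _*_; _∸_; _<_; _!; NonZero)
open import Data.Nat.ListAction using (sum; product)
open import Data.Empty using (⊥)
open import Data.Nat.DivMod using (_mod_)
open import Data.Nat.Combinatorics using (_C_)
open import Data.Nat.Divisibility using (_∣_)
open import Data.Fin using (Fin; toℕ)
open import Data.Integer as ℤ using (ℤ; +_)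
open import Data.List using (List; []; _∷_; map; upTo; foldr)
open import Data.Fin using (Fin)
open import Data.List using (allFin)
open import Data.Nat using (_≡ᵇ_)
open import Data.Bool using (if_then_else_)

leftFact : ℕ → ℕ
leftFact n = sum (map (λ i → i !) (upTo n))

KH : Set
KH = ∀ (n : ℕ) → 2 < n → (n ∣ leftFact n → ⊥)

-- The product (k+1)(k+2)⋯(p-1)  (empty product = 1 when k = p-1)

rprod : ℕ → ℕ → ℕ
rprod k p = product (map (λ i → k + 1 + i) (upTo (p ∸ (k + 1))))

sgn : ℕ → ℤ
sgn zero = + 1
sgn (suc k) = ℤ.- sgn k

module GF (p : ℕ) .{{_ : NonZero p}} where

  F : Set
  F = Fin p

  ιℕ : ℕ → F
  ιℕ n = n mod p

  0F 1F : F
  0F = 0 mod p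
  1F = 1 mod p

  _+F_ _*F_ : F → F → F
  x +F y = (toℕ x + toℕ y) mod p
  x *F y = (toℕ x * toℕ y) mod p

  -F_ : F → F
  -F x = (p ∸ toℕ x) mod p

  -- multiplicative inverse: the (first) y ∈ GF(p) with x * y = 1
  -- (returns 0 if no inverse exists, i.e. for x = 0)
  inv : F → F
  inv x = foldr (λ y r → if toℕ (x *F y) ≡ᵇ toℕ 1F then y else r) 0F (allFin p)

  ΣF : (ℕ → F) → F
  ΣF f = foldr (λ k acc → f k +F acc) 0F (upTo p)

  signF : ℕ → F
  signF zero = 1F
  signF (suc k) = -F signF k

  sum1 sum3 sum5 sum6 : F
  sum1 = ΣF (λ k → signF k *F ιℕ (rprod k p))
  sum3 = ΣF (λ k → ιℕ ((p ∸ 1) C k) *F ιℕ (rprod k p))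
  sum5 = ΣF (λ k → signF k *F inv (ιℕ (k !)))
  sum6 = ΣF (λ k → inv (ιℕ (k !)) *F ιℕ ((p ∸ 1) C k))

intSum2 : ℕ → ℤ
intSum2 p = foldr ℤ._+_ (+ 0) (map (λ k → sgn k ℤ.* + rprod k p) (upTo p))

natSum4 : ℕ → ℕ
natSum4 p = sum (map (λ k → ((p ∸ 1) C k) * rprod k p) (upTo p))

-- Modulo an odd prime p each of the six sums is a unit multiple of !p.  The engine is the
-- congruence (p-1)(p-2)⋯(p-j) ≡ (-1)^j j! (mod p).  For j = k it gives binom(p-1,k) ≡ (-1)^k;
-- for j = p-1-k, as p-1 is even, it gives (-1)^k (k+1)⋯(p-1) ≡ (p-1-k)!, so sum (2) is !p summed
-- backwards.  Sums (1), (3), (4) agree with (2) term by term, (p-1)! times sum (5) is sum (2)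
-- since k! (k+1)⋯(p-1) = (p-1)!, and (6) agrees with (5).  Finally KH only concerns odd primes:
-- if n ∣ !n then every divisor d of n divides !d, because d ∣ k! for k ≥ d, and every n > 2 has
-- an odd prime divisor or is divisible by 4, while !4 = 10.

module Submission where

open import Defs
open import Data.Nat using (ℕ)
import Data.Nat as ℕ
open import Data.Nat.Primality using (Prime; prime⇒nonZero)
open import Data.Nat.Divisibility using (_∣_)
open import Data.Integer using (+_)
open import Data.Integer.Divisibility using () renaming (_∣_ to _∣ℤ_)
open import Data.Product using (_×_)
open import Function.Bundles using (_⇔_)
open import Relation.Nullary using (¬_)
open import Relation.Binary.PropositionalEquality using (_≢_)

open import Data.Integer as ℤ using (ℤ)
import Data.Integer.Properties as ℤₚ
open import Data.Integer.Divisibility.Signed as Signed using (divides) renaming (_∣_ to _∣ˢ_)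
open import Data.Integer.Tactic.RingSolver using (solve-∀)
open import Data.List using (List; []; _∷_; [_]; _++_; map; foldr; upTo; applyUpTo; applyDownFrom; allFin; reverse)
open import Data.List.Properties using (map-upTo; map-++; upTo-∷ʳ; reverse-applyUpTo)
open import Data.List.Membership.Propositional using (_∈_)
open import Data.List.Membership.Propositional.Properties using (∈-upTo⁻; ∈-allFin)
open import Data.List.Relation.Unary.Any using (here; there)
open import Data.List.Relation.Unary.All using (_∷_)
open import Data.List.Relation.Binary.Permutation.Propositional.Properties using (↭-reverse)
open import Data.Fin using (toℕ)
open import Data.Fin.Properties using (toℕ-fromℕ<; toℕ-injective; toℕ<n; toℕ≤n)
open import Data.Bool using (true; false; T; if_then_else_)
open import Data.Product using (∃; _,_; proj₂)
open import Data.Sum using (_⊎_; inj₁; inj₂)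
open import Data.Empty using (⊥-elim)
open import Function using (_∘_)
open import Function.Bundles using (mk⇔; Equivalence)
open import Function.Construct.Composition using (_⇔-∘_)
open import Function.Construct.Symmetry using (⇔-sym)
open import Relation.Nullary using (yes; no)
open import Relation.Nullary.Decidable using (toWitnessFalse)
open import Relation.Binary.Bundles using (Setoid)
open import Relation.Binary.Structures using (IsEquivalence)
open import Relation.Binary.PropositionalEquality using (_≡_; refl; sym; trans; cong; subst; module ≡-Reasoning)
import Relation.Binary.Reasoning.Setoid as SetoidReasoning

sumℤ : List ℤ → ℤ
sumℤ = foldr ℤ._+_ (+ 0)

module ModularCongruence (m : ℕ) where

  open import Data.Integer using (_+_; _*_; -_; _-_)

  -- A record rather than a synonym for divisibility, so that i and j stay inferable.
  infix 4 _≈_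
  record _≈_ (i j : ℤ) : Set where
    constructor ∣-diff
    field m∣i-j : + m ∣ˢ i - j

  private
    _via_ : ∀ {i j k} → + m ∣ˢ k → k ≡ i - j → i ≈ j
    m∣k via eq = ∣-diff (subst (+ m ∣ˢ_) eq m∣k)

  ≈-refl : ∀ {i} → i ≈ i
  ≈-refl {i} = ∣-diff (divides (+ 0) (ℤₚ.+-inverseʳ i))

  ≈-reflexive : ∀ {i j} → i ≡ j → i ≈ j
  ≈-reflexive refl = ≈-refl

  ≈-sym : ∀ {i j} → i ≈ j → j ≈ i
  ≈-sym {i} {j} (∣-diff d) = Signed.∣m⇒∣-m d via ring i j
    where ring : ∀ i j → - (i - j) ≡ j - i
          ring = solve-∀

  ≈-trans : ∀ {i j k} → i ≈ j → j ≈ k → i ≈ k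
  ≈-trans {i} {j} {k} (∣-diff d) (∣-diff e) = Signed.∣m∣n⇒∣m+n d e via ring i j k
    where ring : ∀ i j k → (i - j) + (j - k) ≡ i - k
          ring = solve-∀

  ≈-isEquivalence : IsEquivalence _≈_
  ≈-isEquivalence = record { refl = ≈-refl ; sym = ≈-sym ; trans = ≈-trans }

  ≈-setoid : Setoid _ _
  ≈-setoid = record { isEquivalence = ≈-isEquivalence }

  module ≈-Reasoning = SetoidReasoning ≈-setoid

  +-cong : ∀ {i j k l} → i ≈ j → k ≈ l → i + k ≈ j + l
  +-cong {i} {j} {k} {l} (∣-diff d) (∣-diff e) = Signed.∣m∣n⇒∣m+n d e via ring i j k l
    where ring : ∀ i j k l → (i - j) + (k - l) ≡ (i + k) - (j + l)
          ring = solve-∀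

  *-cong : ∀ {i j k l} → i ≈ j → k ≈ l → i * k ≈ j * l
  *-cong {i} {j} {k} {l} (∣-diff d) (∣-diff e) =
    Signed.∣m∣n⇒∣m+n (Signed.∣m⇒∣m*n k d) (Signed.∣n⇒∣m*n j e) via ring i j k l
    where ring : ∀ i j k l → (i - j) * k + j * (k - l) ≡ i * k - j * l
          ring = solve-∀

  -‿cong : ∀ {i j} → i ≈ j → - i ≈ - j
  -‿cong {i} {j} (∣-diff d) = Signed.∣m⇒∣-m d via ring i j
    where ring : ∀ i j → - (i - j) ≡ - i - - j
          ring = solve-∀

  ∣-resp-≈ : ∀ {i j} → i ≈ j → (+ m ∣ˢ i ⇔ + m ∣ˢ j)
  ∣-resp-≈ {i} {j} (∣-diff d) = mk⇔
    (λ m∣i → Signed.∣m+n∣m⇒∣n (subst (+ m ∣ˢ_) (sym (ring i j)) m∣i) d)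
    (λ m∣j → subst (+ m ∣ˢ_) (ring i j) (Signed.∣m∣n⇒∣m+n d m∣j))
    where ring : ∀ i j → (i - j) + j ≡ i
          ring = solve-∀

  ≈0⇔∣ : ∀ {i} → i ≈ + 0 ⇔ + m ∣ˢ i
  ≈0⇔∣ {i} = mk⇔ (λ (∣-diff d) → subst (+ m ∣ˢ_) (ℤₚ.+-identityʳ i) d)
                  (λ d → d via sym (ℤₚ.+-identityʳ i))

  +-multiple-≈ : ∀ i q → i + q * + m ≈ i
  +-multiple-≈ i q = divides q refl via ring i q (+ m)
    where ring : ∀ i q m → q * m ≡ (i + q * m) - i
          ring = solve-∀

  complement-≈ : ∀ a b → a ℕ.+ b ≡ m → + a ≈ - + b
  complement-≈ a b a+b≡m = divides (+ 1) +a++b≡1*m via ring (+ a) (+ b)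
    where ring : ∀ i j → i + j ≡ i - - j
          ring = solve-∀
          +a++b≡1*m : + a + + b ≡ + 1 * + m
          +a++b≡1*m = trans (sym (ℤₚ.pos-+ a b)) (trans (cong +_ a+b≡m) (sym (ℤₚ.*-identityˡ (+ m))))

  sumℤ-cong : ∀ {A : Set} {f g : A → ℤ} xs → (∀ {x} → x ∈ xs → f x ≈ g x) →
              sumℤ (map f xs) ≈ sumℤ (map g xs)
  sumℤ-cong []       f≈g = ≈-refl
  sumℤ-cong (x ∷ xs) f≈g = +-cong (f≈g (here refl)) (sumℤ-cong xs (f≈g ∘ there))

  sumℤ-upTo-cong : ∀ {f g : ℕ → ℤ} n → (∀ {k} → k ℕ.< n → f k ≈ g k) →
                   sumℤ (map f (upTo n)) ≈ sumℤ (map g (upTo n))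
  sumℤ-upTo-cong n f≈g = sumℤ-cong (upTo n) (f≈g ∘ ∈-upTo⁻)

open import Data.Nat
  using (zero; suc; _+_; _*_; _∸_; _<_; _≤_; _≤′_; ≤′-refl; ≤′-step; _!; _≤ᵇ_; _≡ᵇ_; NonZero
        ; s≤s; z<s; >-nonZero; >-nonZero⁻¹; nonTrivial⇒n>1)
open import Data.Nat.Properties
open import Data.Nat.DivMod using (_%_; _/_; m≡m%n+[m/n]*n; m*[n/m]≡n)
open import Data.Nat.Divisibility
  using (divides; _∣?_; ∣-refl; ∣-trans; ∣m∣n⇒∣m+n; ∣m+n∣m⇒∣n; ∣⇒≤; >⇒∤; ∣1⇒≡1; m∣m*n; m≤n⇒m!∣n!)
open import Data.Nat.Primality using (prime⇒nonTrivial; prime⇒irreducible; euclidsLemma; ¬prime[1])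
open import Data.Nat.Primality.Factorisation using (factorise)
open import Data.Nat.Coprimality using (Coprime; coprime-Bézout)
open import Data.Nat.GCD using (module Bézout)
open import Data.Nat.ListAction using (sum; product)
open import Data.Nat.ListAction.Properties using (sum-↭; sum-++; product-++)
open import Data.Nat.Combinatorics using (_C_; _P_; nCk≡nPk/k!)
open import Data.Nat.Combinatorics.Base using (_P′_)
open import Data.Nat.Combinatorics.Specification using (nP′k≡n!/[n∸k]!; k!∣nP′k)
import Data.Nat.Tactic.RingSolver as ℕ-Solver

+-sum : ∀ {A : Set} (f : A → ℕ) xs → + sum (map f xs) ≡ sumℤ (map (+_ ∘ f) xs)
+-sum f []       = refl
+-sum f (x ∷ xs) = trans (ℤₚ.pos-+ (f x) _) (cong (ℤ._+_ (+ f x)) (+-sum f xs))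

*-distribˡ-sumℤ : ∀ {A : Set} c (f : A → ℤ) xs →
                  c ℤ.* sumℤ (map f xs) ≡ sumℤ (map (λ x → c ℤ.* f x) xs)
*-distribˡ-sumℤ c f []       = ℤₚ.*-zeroʳ c
*-distribˡ-sumℤ c f (x ∷ xs) =
  trans (ℤₚ.*-distribˡ-+ c (f x) _) (cong (ℤ._+_ (c ℤ.* f x)) (*-distribˡ-sumℤ c f xs))

+∣ˢ+⇔∣ : ∀ {a b} → + a ∣ˢ + b ⇔ a ∣ b
+∣ˢ+⇔∣ = mk⇔ Signed.∣⇒∣ᵤ Signed.∣ᵤ⇒∣

sum-upTo-reverse : ∀ (f : ℕ → ℕ) n →
                   sum (map (λ k → f (n ∸ suc k)) (upTo n)) ≡ sum (map f (upTo n))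
sum-upTo-reverse f n = begin
  sum (map (λ k → f (n ∸ suc k)) (upTo n))  ≡⟨ cong sum (map-upTo _ n) ⟩
  sum (applyUpTo (λ k → f (n ∸ suc k)) n)   ≡⟨ cong sum (applyUpTo≡applyDownFrom n) ⟩
  sum (applyDownFrom f n)                   ≡⟨ cong sum (reverse-applyUpTo f n) ⟨
  sum (reverse (applyUpTo f n))             ≡⟨ sum-↭ (↭-reverse (applyUpTo f n)) ⟩
  sum (applyUpTo f n)                       ≡⟨ cong sum (map-upTo f n) ⟨
  sum (map f (upTo n))                      ∎
  where
  open ≡-Reasoning
  applyUpTo≡applyDownFrom : ∀ n → applyUpTo (λ k → f (n ∸ suc k)) n ≡ applyDownFrom f n
  applyUpTo≡applyDownFrom zero    = refl
  applyUpTo≡applyDownFrom (suc n) = cong (f n ∷_) (applyUpTo≡applyDownFrom n)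

sgn-+ : ∀ a b → sgn (a + b) ≡ sgn a ℤ.* sgn b
sgn-+ zero    b = sym (ℤₚ.*-identityˡ (sgn b))
sgn-+ (suc a) b = trans (cong ℤ.-_ (sgn-+ a b)) (ℤₚ.neg-distribˡ-* (sgn a) (sgn b))

sgn-even : ∀ {n} → 2 ∣ n → sgn n ≡ + 1
sgn-even (divides q refl) = sgn[q*2] q
  where
  sgn[q*2] : ∀ q → sgn (q * 2) ≡ + 1
  sgn[q*2] zero    = refl
  sgn[q*2] (suc q) = trans (ℤₚ.neg-involutive _) (sgn[q*2] q)

odd⇒2∣n∸1 : ∀ n → ¬ 2 ∣ n → 2 ∣ n ∸ 1
odd⇒2∣n∸1 zero                2∤0   = ⊥-elim (2∤0 (divides 0 refl))
odd⇒2∣n∸1 (suc zero)          _     = divides 0 refl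
odd⇒2∣n∸1 (suc (suc zero))    2∤2   = ⊥-elim (2∤2 ∣-refl)
odd⇒2∣n∸1 (suc (suc (suc n))) 2∤n+3 =
  ∣m∣n⇒∣m+n ∣-refl (odd⇒2∣n∸1 (suc n) (2∤n+3 ∘ ∣m∣n⇒∣m+n ∣-refl))

rising : ℕ → ℕ → ℕ
rising k m = product (map (λ i → k + 1 + i) (upTo m))

rising-suc : ∀ k m → rising k (suc m) ≡ rising k m * suc (k + m)
rising-suc k m = begin
  product (map g (upTo (suc m)))            ≡⟨ cong (product ∘ map g) (upTo-∷ʳ m) ⟨
  product (map g (upTo m ++ [ m ]))         ≡⟨ cong product (map-++ g (upTo m) [ m ]) ⟩
  product (map g (upTo m) ++ [ g m ])       ≡⟨ product-++ (map g (upTo m)) [ g m ] ⟩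
  rising k m * ((k + 1 + m) * 1)            ≡⟨ ring (rising k m) k m ⟩
  rising k m * suc (k + m)                  ∎
  where
  open ≡-Reasoning
  g : ℕ → ℕ
  g i = k + 1 + i
  ring : ∀ r k m → r * ((k + 1 + m) * 1) ≡ r * suc (k + m)
  ring = ℕ-Solver.solve-∀

k!*rising≡[k+m]! : ∀ k m → k ! * rising k m ≡ (k + m) !
k!*rising≡[k+m]! k zero    = trans (*-identityʳ (k !)) (cong _! (sym (+-identityʳ k)))
k!*rising≡[k+m]! k (suc m) = begin
  k ! * rising k (suc m)           ≡⟨ cong (k ! *_) (rising-suc k m) ⟩
  k ! * (rising k m * suc (k + m)) ≡⟨ *-assoc (k !) _ _ ⟨
  k ! * rising k m * suc (k + m)   ≡⟨ cong (_* suc (k + m)) (k!*rising≡[k+m]! k m) ⟩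
  (k + m) ! * suc (k + m)          ≡⟨ *-comm ((k + m) !) _ ⟩
  suc (k + m) !                    ≡⟨ cong _! (+-suc k m) ⟨
  (k + suc m) !                    ∎
  where open ≡-Reasoning

[n∸k]!*nP′k≡n! : ∀ {n k} → k ≤ n → (n ∸ k) ! * (n P′ k) ≡ n !
[n∸k]!*nP′k≡n! {n} {k} k≤n = trans (cong ((n ∸ k) ! *_) (nP′k≡n!/[n∸k]! k≤n))
                                   (m*[n/m]≡n (m≤n⇒m!∣n! (m∸n≤m n k)))
  where instance _ = (n ∸ k) !≢0

rising≡P′ : ∀ k m → rising k m ≡ (k + m) P′ m
rising≡P′ k m = *-cancelˡ-≡ _ _ (k !) {{k !≢0}} (begin
  k ! * rising k m                ≡⟨ k!*rising≡[k+m]! k m ⟩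
  (k + m) !                       ≡⟨ [n∸k]!*nP′k≡n! (m≤n+m m k) ⟨
  (k + m ∸ m) ! * ((k + m) P′ m)  ≡⟨ cong (λ j → j ! * ((k + m) P′ m)) (m+n∸n≡m k m) ⟩
  k ! * ((k + m) P′ m)            ∎)
  where open ≡-Reasoning

k!*nCk≡nP′k : ∀ {n k} → k ≤ n → k ! * (n C k) ≡ n P′ k
k!*nCk≡nP′k {n} {k} k≤n = begin
  k ! * (n C k)           ≡⟨ cong (k ! *_) (nCk≡nPk/k! k≤n) ⟩
  k ! * ((n P k) / k !)   ≡⟨ cong (λ x → k ! * (x / k !)) nPk≡nP′k ⟩
  k ! * ((n P′ k) / k !)  ≡⟨ m*[n/m]≡n (k!∣nP′k k≤n) ⟩
  n P′ k                  ∎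
  where
  open ≡-Reasoning
  instance _ = k !≢0
  nPk≡nP′k : n P k ≡ n P′ k
  nPk≡nP′k with k ≤ᵇ n | ≤⇒≤ᵇ k≤n
  ... | true | _ = refl

module _ (m : ℕ) where

  open ModularCongruence m

  [m∸1]P′j≈sgn*j! : ∀ j → j ≤ m → + ((m ∸ 1) P′ j) ≈ sgn j ℤ.* + (j !)
  [m∸1]P′j≈sgn*j! zero    _   = ≈-refl
  [m∸1]P′j≈sgn*j! (suc j) j<m = begin
    + ((m ∸ 1 ∸ j) * ((m ∸ 1) P′ j))                ≡⟨ ℤₚ.pos-* (m ∸ 1 ∸ j) _ ⟩
    + (m ∸ 1 ∸ j) ℤ.* + ((m ∸ 1) P′ j)              ≈⟨ *-cong (complement-≈ _ _ m∸1∸j+[1+j]≡m)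
                                                              ([m∸1]P′j≈sgn*j! j (<⇒≤ j<m)) ⟩
    ℤ.- + suc j ℤ.* (sgn j ℤ.* + (j !))             ≡⟨ ring (+ suc j) (sgn j) (+ (j !)) ⟩
    ℤ.- sgn j ℤ.* (+ suc j ℤ.* + (j !))             ≡⟨ cong (ℤ._*_ (ℤ.- sgn j)) (ℤₚ.pos-* (suc j) (j !)) ⟨
    sgn (suc j) ℤ.* + (suc j !)                     ∎
    where
    open ≈-Reasoning
    ring : ∀ a s f → ℤ.- a ℤ.* (s ℤ.* f) ≡ ℤ.- s ℤ.* (a ℤ.* f)
    ring = solve-∀
    m∸1∸j+[1+j]≡m : m ∸ 1 ∸ j + suc j ≡ m
    m∸1∸j+[1+j]≡m = trans (cong (_+ suc j) (∸-+-assoc m 1 j)) (m∸n+n≡m j<m)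

m∣n∧n<m⇒n≡0 : ∀ {m} n → m ∣ n → n < m → n ≡ 0
m∣n∧n<m⇒n≡0 zero    _   _   = refl
m∣n∧n<m⇒n≡0 (suc n) m∣n n<m = ⊥-elim (>⇒∤ n<m m∣n)

module Residues (p : ℕ) {{_ : NonZero p}} where

  open GF p
  open ModularCongruence p

  ≈-canonical : ∀ {a b} → a ≤ b → b < p → + b ≈ + a → a ≡ b
  ≈-canonical {a} {b} a≤b b<p (∣-diff p∣b-a) =
    ≤-antisym a≤b (m∸n≡0⇒m≤n (m∣n∧n<m⇒n≡0 (b ∸ a) p∣b∸a b∸a<p))
    where
    p∣b∸a : p ∣ b ∸ a
    p∣b∸a = Signed.∣⇒∣ᵤ (subst (+ p ∣ˢ_) (trans (ℤₚ.m-n≡m⊖n b a) (ℤₚ.⊖-≥ a≤b)) p∣b-a)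
    b∸a<p : b ∸ a < p
    b∸a<p = ≤-<-trans (m∸n≤m b a) b<p

  toℤ : F → ℤ
  toℤ x = + toℕ x

  toℤ-ιℕ : ∀ n → toℤ (ιℕ n) ≈ + n
  toℤ-ιℕ n = ≈-sym (begin
    + n                                ≡⟨ cong +_ (m≡m%n+[m/n]*n n p) ⟩
    + (n % p + n / p * p)              ≡⟨ ℤₚ.pos-+ (n % p) _ ⟩
    + (n % p) ℤ.+ + (n / p * p)        ≡⟨ cong (ℤ._+_ (+ (n % p))) (ℤₚ.pos-* (n / p) p) ⟩
    + (n % p) ℤ.+ + (n / p) ℤ.* + p    ≈⟨ +-multiple-≈ (+ (n % p)) (+ (n / p)) ⟩
    + (n % p)                          ≡⟨ cong +_ (toℕ-fromℕ< _) ⟨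
    toℤ (ιℕ n)                         ∎)
    where open ≈-Reasoning

  toℤ-+ : ∀ x y → toℤ (x +F y) ≈ toℤ x ℤ.+ toℤ y
  toℤ-+ x y = ≈-trans (toℤ-ιℕ _) (≈-reflexive (ℤₚ.pos-+ (toℕ x) (toℕ y)))

  toℤ-* : ∀ x y → toℤ (x *F y) ≈ toℤ x ℤ.* toℤ y
  toℤ-* x y = ≈-trans (toℤ-ιℕ _) (≈-reflexive (ℤₚ.pos-* (toℕ x) (toℕ y)))

  toℤ-neg : ∀ x → toℤ (-F x) ≈ ℤ.- toℤ x
  toℤ-neg x = ≈-trans (toℤ-ιℕ _) (complement-≈ _ _ (m∸n+n≡m (toℕ≤n x)))

  toℤ-signF : ∀ k → toℤ (signF k) ≈ sgn k
  toℤ-signF zero    = toℤ-ιℕ 1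
  toℤ-signF (suc k) = ≈-trans (toℤ-neg (signF k)) (-‿cong (toℤ-signF k))

  toℤ-ΣF : ∀ f → toℤ (ΣF f) ≈ sumℤ (map (toℤ ∘ f) (upTo p))
  toℤ-ΣF f = go (upTo p)
    where
    go : ∀ ks → toℤ (foldr (λ k acc → f k +F acc) 0F ks) ≈ sumℤ (map (toℤ ∘ f) ks)
    go []       = toℤ-ιℕ 0
    go (k ∷ ks) = ≈-trans (toℤ-+ (f k) _) (+-cong (≈-refl {toℤ (f k)}) (go ks))

  toℤ-injective : ∀ {x y} → toℤ x ≈ toℤ y → x ≡ y
  toℤ-injective {x} {y} x≈y with ≤-total (toℕ x) (toℕ y)
  ... | inj₁ x≤y = toℕ-injective (≈-canonical x≤y (toℕ<n y) (≈-sym x≈y))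
  ... | inj₂ y≤x = sym (toℕ-injective (≈-canonical y≤x (toℕ<n x) x≈y))

  ≡0F⇔∣ : ∀ {x} → x ≡ 0F ⇔ + p ∣ˢ toℤ x
  ≡0F⇔∣ {x} = mk⇔ to from
    where
    to : x ≡ 0F → + p ∣ˢ toℤ x
    to refl = Equivalence.to ≈0⇔∣ (toℤ-ιℕ 0)
    from : + p ∣ˢ toℤ x → x ≡ 0F
    from p∣x = toℤ-injective (≈-trans (Equivalence.from ≈0⇔∣ p∣x) (≈-sym (toℤ-ιℕ 0)))

  inv-inverse : ∀ {x y} → x *F y ≡ 1F → x *F inv x ≡ 1F
  inv-inverse {x} {y} xy≡1 = search (allFin p) (∈-allFin y)
    where
    search : ∀ zs → y ∈ zs → x *F foldr (λ z r → if toℕ (x *F z) ≡ᵇ toℕ 1F then z else r) 0F zs ≡ 1F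
    search (z ∷ zs) _ with toℕ (x *F z) ≡ᵇ toℕ 1F in eq
    ... | true = toℕ-injective (≡ᵇ⇒≡ _ _ (subst T (sym eq) _))
    search (z ∷ zs) (here refl)  | false = ⊥-elim (subst T eq (≡⇒≡ᵇ _ _ (cong toℕ xy≡1)))
    search (z ∷ zs) (there y∈zs) | false = search zs y∈zs

module PrimeModulus (p : ℕ) (p-prime : Prime p) where

  instance
    p≢0 : NonZero p
    p≢0 = prime⇒nonZero p-prime

  open GF p
  open ModularCongruence p
  open Residues p

  p∤k! : ∀ {k} → k < p → ¬ p ∣ k !
  p∤k! {zero}  _   p∣1  = ¬prime[1] (subst Prime (∣1⇒≡1 p∣1) p-prime)
  p∤k! {suc k} k<p p∣k! with euclidsLemma (suc k) (k !) p-prime p∣k!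
  ... | inj₁ p∣1+k = >⇒∤ k<p p∣1+k
  ... | inj₂ p∣k!  = p∤k! (<⇒≤ k<p) p∣k!

  ∣-cancelˡ : ∀ {a i} → ¬ p ∣ a → + p ∣ˢ + a ℤ.* i → + p ∣ˢ i
  ∣-cancelˡ {a} {i} p∤a p∣ai with euclidsLemma a ℤ.∣ i ∣ p-prime (subst (p ∣_) (ℤₚ.abs-* (+ a) i) (Signed.∣⇒∣ᵤ p∣ai))
  ... | inj₁ p∣a = ⊥-elim (p∤a p∣a)
  ... | inj₂ p∣i = Signed.∣ᵤ⇒∣ p∣i

  *-cancelˡ-≈ : ∀ {a i j} → ¬ p ∣ a → + a ℤ.* i ≈ + a ℤ.* j → i ≈ j
  *-cancelˡ-≈ {a} {i} {j} p∤a (∣-diff p∣ai-aj) =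
    ∣-diff (∣-cancelˡ p∤a (subst (+ p ∣ˢ_) (ring (+ a) i j) p∣ai-aj))
    where ring : ∀ a i j → a ℤ.* i ℤ.- a ℤ.* j ≡ a ℤ.* (i ℤ.- j)
          ring = solve-∀

  binomial≈sgn : ∀ {k} → k < p → + ((p ∸ 1) C k) ≈ sgn k
  binomial≈sgn {k} k<p = *-cancelˡ-≈ (p∤k! k<p) (begin
    + (k !) ℤ.* + ((p ∸ 1) C k)   ≡⟨ ℤₚ.pos-* (k !) _ ⟨
    + (k ! * ((p ∸ 1) C k))       ≡⟨ cong +_ (k!*nCk≡nP′k (∸-monoˡ-≤ 1 k<p)) ⟩
    + ((p ∸ 1) P′ k)              ≈⟨ [m∸1]P′j≈sgn*j! p k (<⇒≤ k<p) ⟩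
    sgn k ℤ.* + (k !)             ≡⟨ ℤₚ.*-comm (sgn k) _ ⟩
    + (k !) ℤ.* sgn k             ∎)
    where open ≈-Reasoning

  p∤⇒coprime : ∀ {a} → ¬ p ∣ a → Coprime a p
  p∤⇒coprime p∤a (d∣a , d∣p) with prime⇒irreducible p-prime d∣p
  ... | inj₁ d≡1 = d≡1
  ... | inj₂ refl = ⊥-elim (p∤a d∣a)

  ιℕ-invertible : ∀ {a} → ¬ p ∣ a → ∃ λ y → ιℕ a *F y ≡ 1F
  ιℕ-invertible {a} p∤a with coprime-Bézout (p∤⇒coprime p∤a)
  ... | Bézout.+- x q 1+qp≡xa = ιℕ x , toℤ-injective (begin
    toℤ (ιℕ a *F ιℕ x)          ≈⟨ toℤ-* (ιℕ a) (ιℕ x) ⟩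
    toℤ (ιℕ a) ℤ.* toℤ (ιℕ x)   ≈⟨ *-cong (toℤ-ιℕ a) (toℤ-ιℕ x) ⟩
    + a ℤ.* + x                  ≡⟨ ℤₚ.pos-* a x ⟨
    + (a * x)                    ≡⟨ cong +_ (trans (*-comm a x) (sym 1+qp≡xa)) ⟩
    + (1 + q * p)                ≡⟨ trans (ℤₚ.pos-+ 1 _) (cong (ℤ._+_ (+ 1)) (ℤₚ.pos-* q p)) ⟩
    + 1 ℤ.+ + q ℤ.* + p          ≈⟨ +-multiple-≈ (+ 1) (+ q) ⟩
    + 1                          ≈⟨ toℤ-ιℕ 1 ⟨
    toℤ 1F                       ∎)
    where open ≈-Reasoning
  ... | Bézout.-+ x q 1+xa≡qp = -F ιℕ x , toℤ-injective (begin
    toℤ (ιℕ a *F (-F ιℕ x))                 ≈⟨ toℤ-* (ιℕ a) (-F ιℕ x) ⟩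
    toℤ (ιℕ a) ℤ.* toℤ (-F ιℕ x)            ≈⟨ *-cong (toℤ-ιℕ a) (≈-trans (toℤ-neg (ιℕ x)) (-‿cong (toℤ-ιℕ x))) ⟩
    + a ℤ.* ℤ.- + x                          ≡⟨ ring (+ 1) (+ a) (+ x) ⟩
    + 1 ℤ.- (+ 1 ℤ.+ + x ℤ.* + a)            ≡⟨ cong (λ z → + 1 ℤ.- (+ 1 ℤ.+ z)) (ℤₚ.pos-* x a) ⟨
    + 1 ℤ.- (+ 1 ℤ.+ + (x * a))              ≡⟨ cong (λ z → + 1 ℤ.- z) (trans (sym (ℤₚ.pos-+ 1 (x * a))) (cong +_ 1+xa≡qp)) ⟩
    + 1 ℤ.- + (q * p)                        ≡⟨ cong (λ z → + 1 ℤ.- z) (ℤₚ.pos-* q p) ⟩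
    + 1 ℤ.- + q ℤ.* + p                      ≡⟨ cong (ℤ._+_ (+ 1)) (ℤₚ.neg-distribˡ-* (+ q) (+ p)) ⟩
    + 1 ℤ.+ ℤ.- + q ℤ.* + p                  ≈⟨ +-multiple-≈ (+ 1) (ℤ.- + q) ⟩
    + 1                                      ≈⟨ toℤ-ιℕ 1 ⟨
    toℤ 1F                                   ∎)
    where
    open ≈-Reasoning
    ring : ∀ o a x → a ℤ.* ℤ.- x ≡ o ℤ.- (o ℤ.+ x ℤ.* a)
    ring = solve-∀

  ιℕ*inv≈1 : ∀ {a} → ¬ p ∣ a → + a ℤ.* toℤ (inv (ιℕ a)) ≈ + 1
  ιℕ*inv≈1 {a} p∤a = begin
    + a ℤ.* toℤ (inv (ιℕ a))          ≈⟨ *-cong (toℤ-ιℕ a) (≈-refl {toℤ (inv (ιℕ a))}) ⟨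
    toℤ (ιℕ a) ℤ.* toℤ (inv (ιℕ a))   ≈⟨ toℤ-* (ιℕ a) (inv (ιℕ a)) ⟨
    toℤ (ιℕ a *F inv (ιℕ a))          ≡⟨ cong toℤ (inv-inverse {ιℕ a} (proj₂ (ιℕ-invertible p∤a))) ⟩
    toℤ 1F                            ≈⟨ toℤ-ιℕ 1 ⟩
    + 1                               ∎
    where open ≈-Reasoning

  ∣⇔∣-*-unit : ∀ {a i} → ¬ p ∣ a → + p ∣ˢ i ⇔ + p ∣ˢ + a ℤ.* i
  ∣⇔∣-*-unit {a} p∤a = mk⇔ (Signed.∣n⇒∣m*n (+ a)) (∣-cancelˡ p∤a)

module OddPrime (p : ℕ) (p-prime : Prime p) (p-odd : ¬ 2 ∣ p) where

  open PrimeModulus p p-prime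
  open GF p
  open ModularCongruence p
  open Residues p

  k+[p∸[1+k]]≡p∸1 : ∀ {k} → k < p → k + (p ∸ suc k) ≡ p ∸ 1
  k+[p∸[1+k]]≡p∸1 k<p = cong (_∸ 1) (m+[n∸m]≡n k<p)

  rprod≡rising : ∀ k → rprod k p ≡ rising k (p ∸ suc k)
  rprod≡rising k = cong (rising k ∘ (p ∸_)) (+-comm k 1)

  k!*rprod≡[p∸1]! : ∀ {k} → k < p → k ! * rprod k p ≡ (p ∸ 1) !
  k!*rprod≡[p∸1]! {k} k<p = begin
    k ! * rprod k p              ≡⟨ cong (k ! *_) (rprod≡rising k) ⟩
    k ! * rising k (p ∸ suc k)   ≡⟨ k!*rising≡[k+m]! k (p ∸ suc k) ⟩
    (k + (p ∸ suc k)) !          ≡⟨ cong _! (k+[p∸[1+k]]≡p∸1 k<p) ⟩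
    (p ∸ 1) !                    ∎
    where open ≡-Reasoning

  sgn*rprod≈[p∸[1+k]]! : ∀ {k} → k < p → sgn k ℤ.* + rprod k p ≈ + ((p ∸ suc k) !)
  sgn*rprod≈[p∸[1+k]]! {k} k<p = begin
    sgn k ℤ.* + rprod k p                   ≡⟨ cong (λ r → sgn k ℤ.* + r) rprod≡P′ ⟩
    sgn k ℤ.* + ((p ∸ 1) P′ j)              ≈⟨ *-cong (≈-refl {sgn k}) ([m∸1]P′j≈sgn*j! p j (m∸n≤m p (suc k))) ⟩
    sgn k ℤ.* (sgn j ℤ.* + (j !))           ≡⟨ ℤₚ.*-assoc (sgn k) (sgn j) _ ⟨
    sgn k ℤ.* sgn j ℤ.* + (j !)             ≡⟨ cong (ℤ._* + (j !)) sgn[k]*sgn[j]≡1 ⟩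
    + 1 ℤ.* + (j !)                         ≡⟨ ℤₚ.*-identityˡ _ ⟩
    + (j !)                                 ∎
    where
    open ≈-Reasoning
    j : ℕ
    j = p ∸ suc k
    rprod≡P′ : rprod k p ≡ (p ∸ 1) P′ j
    rprod≡P′ = trans (rprod≡rising k) (trans (rising≡P′ k j) (cong (_P′ j) (k+[p∸[1+k]]≡p∸1 k<p)))
    sgn[k]*sgn[j]≡1 : sgn k ℤ.* sgn j ≡ + 1
    sgn[k]*sgn[j]≡1 = trans (sym (sgn-+ k j))
                      (trans (cong sgn (k+[p∸[1+k]]≡p∸1 k<p)) (sgn-even (odd⇒2∣n∸1 p p-odd)))

  intSum2≈leftFact : intSum2 p ≈ + leftFact p
  intSum2≈leftFact = begin
    intSum2 p                                       ≈⟨ sumℤ-upTo-cong p sgn*rprod≈[p∸[1+k]]! ⟩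
    sumℤ (map (λ k → + ((p ∸ suc k) !)) (upTo p))   ≡⟨ +-sum (λ k → (p ∸ suc k) !) (upTo p) ⟨
    + sum (map (λ k → (p ∸ suc k) !) (upTo p))      ≡⟨ cong +_ (sum-upTo-reverse _! p) ⟩
    + leftFact p                                    ∎
    where open ≈-Reasoning

  natSum4≈intSum2 : + natSum4 p ≈ intSum2 p
  natSum4≈intSum2 = begin
    + natSum4 p                                                 ≡⟨ +-sum _ (upTo p) ⟩
    sumℤ (map (λ k → + (((p ∸ 1) C k) * rprod k p)) (upTo p))   ≈⟨ sumℤ-upTo-cong p term ⟩
    intSum2 p                                                   ∎
    where
    open ≈-Reasoning
    term : ∀ {k} → k < p → + (((p ∸ 1) C k) * rprod k p) ≈ sgn k ℤ.* + rprod k p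
    term {k} k<p = ≈-trans (≈-reflexive (ℤₚ.pos-* ((p ∸ 1) C k) (rprod k p)))
                           (*-cong (binomial≈sgn k<p) (≈-refl {+ rprod k p}))

  sum1≈intSum2 : toℤ sum1 ≈ intSum2 p
  sum1≈intSum2 = begin
    toℤ sum1                                                      ≈⟨ toℤ-ΣF _ ⟩
    sumℤ (map (toℤ ∘ λ k → signF k *F ιℕ (rprod k p)) (upTo p))   ≈⟨ sumℤ-upTo-cong p term ⟩
    intSum2 p                                                     ∎
    where
    open ≈-Reasoning
    term : ∀ {k} → k < p → toℤ (signF k *F ιℕ (rprod k p)) ≈ sgn k ℤ.* + rprod k p
    term {k} _ = ≈-trans (toℤ-* (signF k) (ιℕ (rprod k p))) (*-cong (toℤ-signF k) (toℤ-ιℕ (rprod k p)))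

  sum3≈natSum4 : toℤ sum3 ≈ + natSum4 p
  sum3≈natSum4 = begin
    toℤ sum3                                                              ≈⟨ toℤ-ΣF _ ⟩
    sumℤ (map (toℤ ∘ λ k → ιℕ ((p ∸ 1) C k) *F ιℕ (rprod k p)) (upTo p))  ≈⟨ sumℤ-upTo-cong p term ⟩
    sumℤ (map (λ k → + (((p ∸ 1) C k) * rprod k p)) (upTo p))             ≡⟨ +-sum _ (upTo p) ⟨
    + natSum4 p                                                           ∎
    where
    open ≈-Reasoning
    term : ∀ {k} → k < p → toℤ (ιℕ ((p ∸ 1) C k) *F ιℕ (rprod k p)) ≈ + (((p ∸ 1) C k) * rprod k p)
    term {k} _ = ≈-trans (toℤ-* (ιℕ ((p ∸ 1) C k)) (ιℕ (rprod k p)))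
                         (≈-trans (*-cong (toℤ-ιℕ ((p ∸ 1) C k)) (toℤ-ιℕ (rprod k p)))
                                  (≈-reflexive (sym (ℤₚ.pos-* ((p ∸ 1) C k) (rprod k p)))))

  [p∸1]!*sum5≈intSum2 : + ((p ∸ 1) !) ℤ.* toℤ sum5 ≈ intSum2 p
  [p∸1]!*sum5≈intSum2 = begin
    + c ℤ.* toℤ sum5                                  ≈⟨ *-cong (≈-refl {+ c}) (toℤ-ΣF f) ⟩
    + c ℤ.* sumℤ (map (toℤ ∘ f) (upTo p))             ≡⟨ *-distribˡ-sumℤ (+ c) (toℤ ∘ f) (upTo p) ⟩
    sumℤ (map (λ k → + c ℤ.* toℤ (f k)) (upTo p))     ≈⟨ sumℤ-upTo-cong p term ⟩
    intSum2 p                                         ∎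
    where
    open ≈-Reasoning
    c : ℕ
    c = (p ∸ 1) !
    f : ℕ → F
    f k = signF k *F inv (ιℕ (k !))
    term : ∀ {k} → k < p → + c ℤ.* toℤ (f k) ≈ sgn k ℤ.* + rprod k p
    term {k} k<p = begin
      + c ℤ.* toℤ (f k)                                   ≈⟨ *-cong (≈-refl {+ c}) (≈-trans (toℤ-* (signF k) I)
                                                                 (*-cong (toℤ-signF k) (≈-refl {toℤ I}))) ⟩
      + c ℤ.* (sgn k ℤ.* toℤ I)                           ≡⟨ cong (λ n → + n ℤ.* (sgn k ℤ.* toℤ I)) (k!*rprod≡[p∸1]! k<p) ⟨
      + (k ! * rprod k p) ℤ.* (sgn k ℤ.* toℤ I)           ≡⟨ cong (ℤ._* (sgn k ℤ.* toℤ I)) (ℤₚ.pos-* (k !) (rprod k p)) ⟩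
      + (k !) ℤ.* + rprod k p ℤ.* (sgn k ℤ.* toℤ I)       ≡⟨ ring (+ (k !)) (+ rprod k p) (sgn k) (toℤ I) ⟩
      sgn k ℤ.* + rprod k p ℤ.* (+ (k !) ℤ.* toℤ I)       ≈⟨ *-cong (≈-refl {sgn k ℤ.* + rprod k p}) (ιℕ*inv≈1 (p∤k! k<p)) ⟩
      sgn k ℤ.* + rprod k p ℤ.* + 1                       ≡⟨ ℤₚ.*-identityʳ _ ⟩
      sgn k ℤ.* + rprod k p                               ∎
      where
      I : F
      I = inv (ιℕ (k !))
      ring : ∀ a r s i → a ℤ.* r ℤ.* (s ℤ.* i) ≡ s ℤ.* r ℤ.* (a ℤ.* i)
      ring = solve-∀

  sum6≈sum5 : toℤ sum6 ≈ toℤ sum5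
  sum6≈sum5 = begin
    toℤ sum6                                                              ≈⟨ toℤ-ΣF _ ⟩
    sumℤ (map (toℤ ∘ λ k → inv (ιℕ (k !)) *F ιℕ ((p ∸ 1) C k)) (upTo p))  ≈⟨ sumℤ-upTo-cong p term ⟩
    sumℤ (map (toℤ ∘ λ k → signF k *F inv (ιℕ (k !))) (upTo p))           ≈⟨ toℤ-ΣF _ ⟨
    toℤ sum5                                                              ∎
    where
    open ≈-Reasoning
    term : ∀ {k} → k < p → toℤ (inv (ιℕ (k !)) *F ιℕ ((p ∸ 1) C k)) ≈ toℤ (signF k *F inv (ιℕ (k !)))
    term {k} k<p = begin
      toℤ (I *F ιℕ ((p ∸ 1) C k))          ≈⟨ toℤ-* I (ιℕ ((p ∸ 1) C k)) ⟩
      toℤ I ℤ.* toℤ (ιℕ ((p ∸ 1) C k))     ≈⟨ *-cong (≈-refl {toℤ I}) (≈-trans (toℤ-ιℕ _) (binomial≈sgn k<p)) ⟩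
      toℤ I ℤ.* sgn k                       ≡⟨ ℤₚ.*-comm (toℤ I) (sgn k) ⟩
      sgn k ℤ.* toℤ I                       ≈⟨ *-cong (toℤ-signF k) (≈-refl {toℤ I}) ⟨
      toℤ (signF k) ℤ.* toℤ I               ≈⟨ toℤ-* (signF k) I ⟨
      toℤ (signF k *F I)                    ∎
      where I : F
            I = inv (ιℕ (k !))

  ∣⇔∣leftFact : ∀ {i} → i ≈ + leftFact p → (+ p ∣ˢ i ⇔ p ∣ leftFact p)
  ∣⇔∣leftFact i≈!p = +∣ˢ+⇔∣ ⇔-∘ ∣-resp-≈ i≈!p

  ≡0F⇔∣leftFact : ∀ {x} → toℤ x ≈ + leftFact p → (x ≡ 0F ⇔ p ∣ leftFact p)
  ≡0F⇔∣leftFact x≈!p = ∣⇔∣leftFact x≈!p ⇔-∘ ≡0F⇔∣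

  ≡0F⇔∣leftFact-unit : ∀ {c x} → ¬ p ∣ c → + c ℤ.* toℤ x ≈ + leftFact p → (x ≡ 0F ⇔ p ∣ leftFact p)
  ≡0F⇔∣leftFact-unit p∤c cx≈!p = ∣⇔∣leftFact cx≈!p ⇔-∘ (∣⇔∣-*-unit p∤c ⇔-∘ ≡0F⇔∣)

  p∤[p∸1]! : ¬ p ∣ (p ∸ 1) !
  p∤[p∸1]! = p∤k! (∸-monoʳ-< z<s (>-nonZero⁻¹ p))

  sum1≡0⇔∣leftFact : sum1 ≡ 0F ⇔ p ∣ leftFact p
  sum1≡0⇔∣leftFact = ≡0F⇔∣leftFact (≈-trans sum1≈intSum2 intSum2≈leftFact)

  ∣intSum2⇔∣leftFact : + p ∣ℤ intSum2 p ⇔ p ∣ leftFact p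
  ∣intSum2⇔∣leftFact = ∣⇔∣leftFact intSum2≈leftFact ⇔-∘ mk⇔ Signed.∣ᵤ⇒∣ Signed.∣⇒∣ᵤ

  sum3≡0⇔∣leftFact : sum3 ≡ 0F ⇔ p ∣ leftFact p
  sum3≡0⇔∣leftFact =
    ≡0F⇔∣leftFact (≈-trans sum3≈natSum4 (≈-trans natSum4≈intSum2 intSum2≈leftFact))

  ∣natSum4⇔∣leftFact : p ∣ natSum4 p ⇔ p ∣ leftFact p
  ∣natSum4⇔∣leftFact = ∣⇔∣leftFact (≈-trans natSum4≈intSum2 intSum2≈leftFact) ⇔-∘ ⇔-sym +∣ˢ+⇔∣

  sum5≡0⇔∣leftFact : sum5 ≡ 0F ⇔ p ∣ leftFact p
  sum5≡0⇔∣leftFact = ≡0F⇔∣leftFact-unit p∤[p∸1]! (≈-trans [p∸1]!*sum5≈intSum2 intSum2≈leftFact)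

  sum6≡0⇔∣leftFact : sum6 ≡ 0F ⇔ p ∣ leftFact p
  sum6≡0⇔∣leftFact = ≡0F⇔∣leftFact-unit p∤[p∸1]!
    (≈-trans (*-cong (≈-refl {+ ((p ∸ 1) !)}) sum6≈sum5)
             (≈-trans [p∸1]!*sum5≈intSum2 intSum2≈leftFact))

leftFact-suc : ∀ n → leftFact (suc n) ≡ leftFact n + n !
leftFact-suc n = begin
  sum (map _! (upTo (suc n)))              ≡⟨ cong (sum ∘ map _!) (upTo-∷ʳ n) ⟨
  sum (map _! (upTo n ++ [ n ]))           ≡⟨ cong sum (map-++ _! (upTo n) [ n ]) ⟩
  sum (map _! (upTo n) ++ [ n ! ])         ≡⟨ sum-++ (map _! (upTo n)) [ n ! ] ⟩
  leftFact n + (n ! + 0)                   ≡⟨ cong (_+_ (leftFact n)) (+-identityʳ (n !)) ⟩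
  leftFact n + n !                         ∎
  where open ≡-Reasoning

d∣n! : ∀ {d n} → 0 < d → d ≤ n → d ∣ n !
d∣n! {suc d} _ d<n = ∣-trans (m∣m*n (d !)) (m≤n⇒m!∣n! d<n)

∣leftFact⇒∣leftFact : ∀ {d n} → 0 < d → d ≤ n → d ∣ leftFact n → d ∣ leftFact d
∣leftFact⇒∣leftFact {d} 0<d d≤n = go (≤⇒≤′ d≤n)
  where
  go : ∀ {n} → d ≤′ n → d ∣ leftFact n → d ∣ leftFact d
  go ≤′-refl            d∣!d = d∣!d
  go (≤′-step {n} d≤′n) d∣!n+1 = go d≤′n (∣m+n∣m⇒∣n d∣n!+!n (d∣n! 0<d (≤′⇒≤ d≤′n)))
    where d∣n!+!n : d ∣ n ! + leftFact n
          d∣n!+!n = subst (d ∣_) (trans (leftFact-suc n) (+-comm _ (n !))) d∣!n+1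

divisor⇒∣leftFact : ∀ {d n} → 0 < d → 0 < n → d ∣ n → n ∣ leftFact n → d ∣ leftFact d
divisor⇒∣leftFact 0<d 0<n d∣n n∣!n =
  ∣leftFact⇒∣leftFact 0<d (∣⇒≤ {{>-nonZero 0<n}} d∣n) (∣-trans d∣n n∣!n)

4∤leftFact[4] : ¬ 4 ∣ leftFact 4
4∤leftFact[4] = toWitnessFalse {a? = 4 ∣? leftFact 4} _

OddPrimeDivisor : ℕ → Set
OddPrimeDivisor n = ∃ λ q → Prime q × ¬ 2 ∣ q × q ∣ n

primeDivisor : ∀ {n} → 2 ≤ n → ∃ λ q → Prime q × q ∣ n
primeDivisor {suc zero} (s≤s ())
primeDivisor {n@(suc (suc _))} _ with factorise n
... | record { factors = [] ; isFactorisation = () }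
... | record { factors = q ∷ qs ; isFactorisation = n≡Πqs ; factorsPrime = q-prime ∷ _ } =
  q , q-prime , subst (q ∣_) (sym n≡Πqs) (m∣m*n (product qs))

oddPrimeDivisor : ∀ {n} → ¬ 2 ∣ n → 2 ≤ n → OddPrimeDivisor n
oddPrimeDivisor 2∤n 2≤n with primeDivisor 2≤n
... | q , q-prime , q∣n = q , q-prime , (2∤n ∘ λ 2∣q → ∣-trans 2∣q q∣n) , q∣n

oddPrimeDivisor⊎4∣ : ∀ n → 2 < n → OddPrimeDivisor n ⊎ 4 ∣ n
oddPrimeDivisor⊎4∣ n 2<n with 2 ∣? n
... | no 2∤n = inj₁ (oddPrimeDivisor 2∤n (<⇒≤ 2<n))
... | yes (divides c refl) with 2 ∣? c
...   | yes (divides e refl) = inj₂ (divides e (*-assoc e 2 2))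
...   | no 2∤c with oddPrimeDivisor 2∤c (*-cancelʳ-< 2 1 c 2<n)
...     | q , q-prime , 2∤q , q∣c = inj₁ (q , q-prime , 2∤q , ∣-trans q∣c (m∣m*n 2))

KH⇔oddPrime∤leftFact : KH ⇔ (∀ p → Prime p → ¬ 2 ∣ p → ¬ p ∣ leftFact p)
KH⇔oddPrime∤leftFact = mk⇔ to from
  where
  to : KH → ∀ p → Prime p → ¬ 2 ∣ p → ¬ p ∣ leftFact p
  to kh p p-prime 2∤p = kh p (≤∧≢⇒< (nonTrivial⇒n>1 p {{prime⇒nonTrivial p-prime}}) 2≢p)
    where 2≢p : 2 ≢ p
          2≢p refl = 2∤p (divides 1 refl)
  from : (∀ p → Prime p → ¬ 2 ∣ p → ¬ p ∣ leftFact p) → KH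
  from oddPrime∤ n 2<n n∣!n with oddPrimeDivisor⊎4∣ n 2<n
  ... | inj₁ (q , q-prime , 2∤q , q∣n) = oddPrime∤ q q-prime 2∤q
    (divisor⇒∣leftFact (>-nonZero⁻¹ q {{prime⇒nonZero q-prime}}) (<-trans z<s 2<n) q∣n n∣!n)
  ... | inj₂ 4∣n = 4∤leftFact[4] (divisor⇒∣leftFact z<s (<-trans z<s 2<n) 4∣n n∣!n)

KH⇔∀oddPrime : ∀ {Q : (p : ℕ) → Prime p → Set} →
               (∀ p p-prime → ¬ 2 ∣ p → Q p p-prime ⇔ p ∣ leftFact p) →
               KH ⇔ (∀ p p-prime → ¬ 2 ∣ p → ¬ Q p p-prime)
KH⇔∀oddPrime Q⇔ = mk⇔
  (λ kh p p-prime 2∤p → to KH⇔oddPrime∤leftFact kh p p-prime 2∤p ∘ to (Q⇔ p p-prime 2∤p))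
  (λ ¬Q → from KH⇔oddPrime∤leftFact λ p p-prime 2∤p → ¬Q p p-prime 2∤p ∘ from (Q⇔ p p-prime 2∤p))
  where open Equivalence

theorem2p1 : (KH ⇔ (∀ (p : ℕ) (pp : Prime p) → ¬ (2 ∣ p) →
    GF.sum1 p {{prime⇒nonZero pp}} ≢ GF.0F p {{prime⇒nonZero pp}}))
    × (KH ⇔ (∀ (p : ℕ) → Prime p → ¬ (2 ∣ p) → ¬ ((+ p) ∣ℤ intSum2 p)))
    × (KH ⇔ (∀ (p : ℕ) (pp : Prime p) → ¬ (2 ∣ p) →
    GF.sum3 p {{prime⇒nonZero pp}} ≢ GF.0F p {{prime⇒nonZero pp}}))
    × (KH ⇔ (∀ (p : ℕ) → Prime p → ¬ (2 ∣ p) → ¬ (p ∣ natSum4 p)))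
    × (KH ⇔ (∀ (p : ℕ) (pp : Prime p) → ¬ (2 ∣ p) →
    GF.sum5 p {{prime⇒nonZero pp}} ≢ GF.0F p {{prime⇒nonZero pp}}))
    × (KH ⇔ (∀ (p : ℕ) (pp : Prime p) → ¬ (2 ∣ p) →
    GF.sum6 p {{prime⇒nonZero pp}} ≢ GF.0F p {{prime⇒nonZero pp}}))
theorem2p1 = KH⇔∀oddPrime OddPrime.sum1≡0⇔∣leftFact
           , KH⇔∀oddPrime OddPrime.∣intSum2⇔∣leftFact
           , KH⇔∀oddPrime OddPrime.sum3≡0⇔∣leftFact
           , KH⇔∀oddPrime OddPrime.∣natSum4⇔∣leftFact
           , KH⇔∀oddPrime OddPrime.sum5≡0⇔∣leftFact
           , KH⇔∀oddPrime OddPrime.sum6≡0⇔∣leftFact
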